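{- Let $\omega\ge 4$ and let $\Gamma$ be a connected graph. Then $C_\omega(L(\Gamma))\cong\Gamma$ if and only if $\Gamma$ is $\omega$-regular.
   Context: All graphs are finite, without loops or parallel edges. The line graph $L(\Gamma)$ has the edges of $\Gamma$ as vertices, two edges being adjacent iff they share an endpoint. For a graph $H$, the $\omega$-clique graph $C_\omega(H)$ is the graph whose vertices are the cliques of order $\omega$ of $H$ (sets of $\omega$ pairwise adjacent vertices), two distinct such cliques being adjacent iff they have nonempty intersection. -}

module Defs where

open import Data.Bool using (Bool; true; false; _∧_; _∨_; not; T)
open import Data.Nat using (ℕ; _<ᵇ_; _≡ᵇ_)
open import Data.Fin using (Fin; toℕ)
open import Data.Fin.Properties using () renaming (_≟_ to _≟ᶠ_)
open import Data.Fin.Subset using (Subset; ∣_∣; _∩_)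
open import Data.Product using (_×_; _,_; Σ; proj₁; proj₂)
open import Data.List as List using (List; []; _∷_; allFin; filterᵇ; cartesianProduct; length)
open import Data.Bool.ListAction using (all; any)
open import Data.Vec as Vec using (Vec; []; _∷_; tabulate; toList)
open import Data.Vec.Properties using (≡-dec)
open import Data.Bool.Properties using () renaming (_≟_ to _≟ᵇ_)
open import Relation.Nullary using (¬_; does)
open import Relation.Binary.PropositionalEquality using (_≡_)
open import Relation.Binary.Construct.Closure.ReflexiveTransitive using (Star)
open import Function.Bundles using (_↔_; Inverse)

record Graph : Set where
  constructor mkGraph
  field
    size : ℕ
    adj  : Fin size → Fin size → Bool
open Graph public

-- Simple graph: symmetric adjacency, no loops (parallel edges impossible by construction).
record IsSimple (G : Graph) : Set where
  field
    sym     : ∀ i j → adj G i j ≡ adj G j i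
    irrefl  : ∀ i → adj G i i ≡ false

_==ᶠ_ : ∀ {n} → Fin n → Fin n → Bool
i ==ᶠ j = does (i ≟ᶠ j)

-- The edges of G, each listed once as an ordered pair (i , j) with i < j.
edges : (G : Graph) → List (Fin (size G) × Fin (size G))
edges G = filterᵇ (λ p → (toℕ (proj₁ p) <ᵇ toℕ (proj₂ p)) ∧ adj G (proj₁ p) (proj₂ p))
                  (cartesianProduct (allFin (size G)) (allFin (size G)))

shareEndpoint : ∀ {n} → Fin n × Fin n → Fin n × Fin n → Bool
shareEndpoint (a , b) (c , d) = (a ==ᶠ c) ∨ (a ==ᶠ d) ∨ (b ==ᶠ c) ∨ (b ==ᶠ d)

lineGraph : Graph → Graph
lineGraph G = mkGraph (length (edges G))
  (λ e f → not (e ==ᶠ f) ∧ shareEndpoint (List.lookup (edges G) e) (List.lookup (edges G) f))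

allSubsets : ∀ n → List (Subset n)
allSubsets ℕ.zero    = [] ∷ []
allSubsets (ℕ.suc n) = List.map (true ∷_) (allSubsets n) List.++ List.map (false ∷_) (allSubsets n)

_∈ᵇ_ : ∀ {n} → Fin n → Subset n → Bool
i ∈ᵇ s = Vec.lookup s i

isCliqueᵇ : (G : Graph) → ℕ → Subset (size G) → Bool
isCliqueᵇ G ω s = (∣ s ∣ ≡ᵇ ω) ∧
  all (λ i → all (λ j → not (i ∈ᵇ s ∧ j ∈ᵇ s ∧ not (i ==ᶠ j)) ∨ adj G i j)
                 (allFin (size G)))
      (allFin (size G))

cliques : (G : Graph) → ℕ → List (Subset (size G))
cliques G ω = filterᵇ (isCliqueᵇ G ω) (allSubsets (size G))

_==ˢ_ : ∀ {n} → Subset n → Subset n → Bool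
s ==ˢ t = does (≡-dec _≟ᵇ_ s t)

nonemptyᵇ : ∀ {n} → Subset n → Bool
nonemptyᵇ s = any (λ b → b) (toList s)

cliqueGraph : ℕ → Graph → Graph
cliqueGraph ω H = mkGraph (length (cliques H ω))
  (λ a b → not (List.lookup (cliques H ω) a ==ˢ List.lookup (cliques H ω) b)
           ∧ nonemptyᵇ (List.lookup (cliques H ω) a ∩ List.lookup (cliques H ω) b))

_≅_ : Graph → Graph → Set
G ≅ H = Σ (Fin (size G) ↔ Fin (size H)) λ φ →
          ∀ i j → adj G i j ≡ adj H (Inverse.to φ i) (Inverse.to φ j)

Adj : (G : Graph) → Fin (size G) → Fin (size G) → Set
Adj G i j = T (adj G i j)

Connected : Graph → Set
Connected G = ∀ i j → Star (Adj G) i j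

degree : (G : Graph) → Fin (size G) → ℕ
degree G i = ∣ tabulate (adj G i) ∣

Regular : ℕ → Graph → Set
Regular k G = ∀ i → degree G i ≡ k

{-# OPTIONS --safe #-}
module Submission where

-- Four pairwise meeting edges of a simple graph share a vertex, so for ω ≥ 4 every ω-clique of
-- L(Γ) is a set of ω edges at a single vertex, its centre.  If Γ is ω-regular the ω-cliques are
-- exactly the stars, and two stars meet iff their centres are adjacent, so v ↦ star v is an
-- isomorphism.  Conversely, let C_ω(L(Γ)) ≅ Γ and let Δ be the maximum degree.  If Δ ≤ ω, every
-- clique is the whole star of its centre, so the centre map is injective, hence onto, and every
-- vertex has degree ≥ ω.  If Δ ≥ ω + 2, exchanging single edges shows that an ω-subset of a
-- largest star meets at least ω (Δ - ω) > Δ other cliques.  If Δ = ω + 1, the cliques star v₀ - e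
-- form a clique of Γ whose vertices all have degree ω (a vertex of degree ω + 1 with two
-- neighbours of degree ≥ ω would force a vertex of degree ω + 2), so it is a connected component
-- missing v₀.

open import Defs
open import Data.Bool using (Bool; true; false; _∧_; _∨_; not; T)
open import Data.Bool.ListAction using (all)
open import Data.Bool.Properties using (T-≡; T-∧; T-∨) renaming (_≟_ to _≟ᵇ_)
open import Data.Empty using (⊥; ⊥-elim)
open import Data.Fin using (Fin; zero; suc; toℕ)
open import Data.Fin.Properties using (any?; injective⇒≤; *↔×; toℕ-injective) renaming (_≟_ to _≟ᶠ_)
import Data.Fin.Properties as Finₚ
open import Data.Fin.Subset hiding (⊥)
open import Data.Fin.Subset.Properties
import Data.List as List
open import Data.List using (List; []; _∷_; length; allFin; cartesianProduct)
open import Data.List.Extrema.Nat using (argmax; f[xs]≤f[argmax])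
open import Data.List.Membership.Propositional using () renaming (_∈_ to _∈ₗ_)
import Data.List.Membership.Propositional.Properties as Listₚ
open import Data.List.Relation.Unary.All using (All; []; _∷_)
import Data.List.Relation.Unary.All as All
import Data.List.Relation.Unary.All.Properties as All
import Data.List.Relation.Unary.AllPairs as AllPairs
import Data.List.Relation.Unary.Any as Any
import Data.List.Relation.Unary.Any.Properties as Any
open import Data.List.Relation.Unary.Unique.Propositional using (Unique)
import Data.List.Relation.Unary.Unique.Propositional.Properties as Unique
open import Data.Nat as ℕ using (ℕ; _≤_; _<_; _+_; _*_; _<ᵇ_; s≤s; z≤n)
open import Data.Nat.Properties
open import Data.Product using (_×_; _,_; ∃; Σ; proj₁; proj₂)
open import Data.Sum using (_⊎_; inj₁; inj₂)
open import Data.Vec using ([]; _∷_; here; there; lookup; tabulate)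
open import Data.Vec.Properties using (lookup∘tabulate; []=⇒lookup; lookup⇒[]=; ∷-injectiveʳ; ≡-dec)
open import Data.Vec.Functional using () renaming (_∷_ to _◂_)
open import Function using (_∘_; id; Injective)
open import Function.Bundles using (_⇔_; mk⇔; Equivalence; Inverse; mk↔ₛ′)
open import Relation.Binary.Construct.Closure.ReflexiveTransitive using (fold)
open import Relation.Binary.Definitions using (tri<; tri≈; tri>)
open import Relation.Binary.PropositionalEquality
open import Relation.Nullary using (¬_; Dec; yes; no; does; contradiction)
open import Relation.Nullary.Decidable using (T?; _⊎-dec_)

open Equivalence using (to; from)

private
  variable
    k n n′ : ℕ
    i j x y x′ y′ : Fin n
    p q r s s′ t : Subset n

T-does : {P : Set} (d : Dec P) → T (does d) ⇔ P
T-does (yes p) = mk⇔ (λ _ → p) (λ _ → _)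
T-does (no ¬p) = mk⇔ (λ ()) ¬p

T-not-does : {P : Set} (d : Dec P) → T (not (does d)) ⇔ (¬ P)
T-not-does (yes p) = mk⇔ (λ ()) (λ ¬p → ¬p p)
T-not-does (no ¬p) = mk⇔ (λ _ → ¬p) (λ _ → _)

T⇔T⇒≡ : {x y : Bool} → T x ⇔ T y → x ≡ y
T⇔T⇒≡ {false} {false} _ = refl
T⇔T⇒≡ {false} {true}  h = ⊥-elim (from h _)
T⇔T⇒≡ {true}  {false} h = ⊥-elim (to h _)
T⇔T⇒≡ {true}  {true}  _ = refl

T-implication : ∀ a b c d → T (not (a ∧ b ∧ not c) ∨ d) ⇔ (T a → T b → ¬ T c → T d)
T-implication true  true  false d = mk⇔ (λ h _ _ _ → h) (λ h → h _ _ (λ ()))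
T-implication true  true  true  d = mk⇔ (λ _ _ _ ¬c → contradiction _ ¬c) (λ _ → _)
T-implication true  false c     d = mk⇔ (λ _ _ ()) (λ _ → _)
T-implication false b     c     d = mk⇔ (λ _ ()) (λ _ → _)

T-nonemptyᵇ : (s : Subset n) → T (nonemptyᵇ s) ⇔ Nonempty s
T-nonemptyᵇ []            = mk⇔ (λ ()) (λ ())
T-nonemptyᵇ (inside  ∷ s) = mk⇔ (λ _ → zero , here) (λ _ → _)
T-nonemptyᵇ (outside ∷ s) = mk⇔
  (λ h → let i , i∈s = to (T-nonemptyᵇ s) h in suc i , there i∈s)
  (λ { (suc i , there i∈s) → from (T-nonemptyᵇ s) (i , i∈s) })

allFin-all⇔ : {f : Fin n → Bool} → T (all f (allFin n)) ⇔ (∀ i → T (f i))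
allFin-all⇔ {f = f} = mk⇔
  (λ h i → All.lookup (All.all⁺ f _ h) (Listₚ.∈-allFin i))
  (λ h → All.all⁻ f {xs = allFin _} (All.tabulate (λ {i} _ → h i)))

∈⇔T-lookup : i ∈ p ⇔ T (lookup p i)
∈⇔T-lookup {i = i} {p = p} =
  mk⇔ (λ i∈p → from T-≡ ([]=⇒lookup i∈p)) (λ h → lookup⇒[]= i p (to T-≡ h))

∈-tabulate : {f : Fin n → Bool} → i ∈ tabulate f ⇔ T (f i)
∈-tabulate {i = i} {f = f} = subst (λ b → i ∈ tabulate f ⇔ T b) (lookup∘tabulate f i) ∈⇔T-lookup

shareEndpoint⇔ : (p q : Fin n × Fin n) →
  T (shareEndpoint p q) ⇔ ∃ λ v → (v ≡ proj₁ p ⊎ v ≡ proj₂ p) × (v ≡ proj₁ q ⊎ v ≡ proj₂ q)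
shareEndpoint⇔ (a , b) (c , d) = mk⇔ shared share
  where
  ≡? : ∀ x y → T (x ==ᶠ y) ⇔ (x ≡ y)
  ≡? x y = T-does (x ≟ᶠ y)
  shared : T (shareEndpoint (a , b) (c , d)) → ∃ λ v → (v ≡ a ⊎ v ≡ b) × (v ≡ c ⊎ v ≡ d)
  shared h with to T-∨ h
  ... | inj₁ a≡c = a , inj₁ refl , inj₁ (to (≡? a c) a≡c)
  ... | inj₂ h′ with to T-∨ h′
  ...   | inj₁ a≡d = a , inj₁ refl , inj₂ (to (≡? a d) a≡d)
  ...   | inj₂ h″ with to T-∨ h″
  ...     | inj₁ b≡c = b , inj₂ refl , inj₁ (to (≡? b c) b≡c)
  ...     | inj₂ b≡d = b , inj₂ refl , inj₂ (to (≡? b d) b≡d)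
  share : (∃ λ v → (v ≡ a ⊎ v ≡ b) × (v ≡ c ⊎ v ≡ d)) → T (shareEndpoint (a , b) (c , d))
  share (v , v∈ab , v∈cd) with a ≟ᶠ c | a ≟ᶠ d | b ≟ᶠ c | b ≟ᶠ d
  ... | yes _ | _     | _     | _     = _
  ... | no _  | yes _ | _     | _     = _
  ... | no _  | no _  | yes _ | _     = _
  ... | no _  | no _  | no _  | yes _ = _
  ... | no a≢c | no a≢d | no b≢c | no b≢d with v∈ab | v∈cd
  ...   | inj₁ refl | inj₁ refl = a≢c refl
  ...   | inj₁ refl | inj₂ refl = a≢d refl
  ...   | inj₂ refl | inj₁ refl = b≢c refl
  ...   | inj₂ refl | inj₂ refl = b≢d refl

-- Counting elements of finite subsets

enumerate : (p : Subset n) → Fin ∣ p ∣ → Fin n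
enumerate (inside  ∷ p) zero    = zero
enumerate (inside  ∷ p) (suc a) = suc (enumerate p a)
enumerate (outside ∷ p) a       = suc (enumerate p a)

enumerate-∈ : (p : Subset n) (a : Fin ∣ p ∣) → enumerate p a ∈ p
enumerate-∈ (inside  ∷ p) zero    = here
enumerate-∈ (inside  ∷ p) (suc a) = there (enumerate-∈ p a)
enumerate-∈ (outside ∷ p) a       = there (enumerate-∈ p a)

enumerate-injective : (p : Subset n) → Injective _≡_ _≡_ (enumerate p)
enumerate-injective (inside  ∷ p) {zero}  {zero}  _  = refl
enumerate-injective (inside  ∷ p) {suc a} {suc b} eq = cong suc (enumerate-injective p (Finₚ.suc-injective eq))
enumerate-injective (outside ∷ p)                 eq = enumerate-injective p (Finₚ.suc-injective eq)

position : i ∈ p → Fin ∣ p ∣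
position {p = inside  ∷ p} here        = zero
position {p = inside  ∷ p} (there i∈p) = suc (position i∈p)
position {p = outside ∷ p} (there i∈p) = position i∈p

enumerate-position : (i∈p : i ∈ p) → enumerate p (position i∈p) ≡ i
enumerate-position {p = inside  ∷ p} here        = refl
enumerate-position {p = inside  ∷ p} (there i∈p) = cong suc (enumerate-position i∈p)
enumerate-position {p = outside ∷ p} (there i∈p) = cong suc (enumerate-position i∈p)

distinct⇒≤∣∣ : (g : Fin k → Fin n) → Injective _≡_ _≡_ g → (∀ a → g a ∈ t) → k ≤ ∣ t ∣
distinct⇒≤∣∣ {t = t} g g-injective g∈t = injective⇒≤ λ {a} {b} eq → g-injective (begin
  g a                          ≡⟨ enumerate-position (g∈t a) ⟨
  enumerate t (position (g∈t a)) ≡⟨ cong (enumerate t) eq ⟩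
  enumerate t (position (g∈t b)) ≡⟨ enumerate-position (g∈t b) ⟩
  g b                          ∎)
  where open ≡-Reasoning

◂-injective : {g : Fin k → Fin n} → Injective _≡_ _≡_ g → (∀ a → g a ≢ x) → Injective _≡_ _≡_ (x ◂ g)
◂-injective g-inj fresh {zero}  {zero}  _  = refl
◂-injective g-inj fresh {zero}  {suc b} eq = contradiction (sym eq) (fresh b)
◂-injective g-inj fresh {suc a} {zero}  eq = contradiction eq (fresh a)
◂-injective g-inj fresh {suc a} {suc b} eq = cong suc (g-inj eq)

-- If some i ∈ t were missed, adding it to g would give suc k distinct elements of t.
distinct-covers : (g : Fin k → Fin n) → Injective _≡_ _≡_ g → (∀ a → g a ∈ t) → ∣ t ∣ ≤ k →
                  i ∈ t → ∃ λ a → g a ≡ i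
distinct-covers {i = i} g g-injective g∈t ∣t∣≤k i∈t with any? (λ a → g a ≟ᶠ i)
... | yes hit = hit
... | no miss = contradiction ∣t∣≤k (<⇒≱ (distinct⇒≤∣∣ (i ◂ g)
      (◂-injective g-injective (λ a eq → miss (a , eq)))
      λ { zero → i∈t ; (suc a) → g∈t a }))

injection⇒∣∣≤ : (f : ∀ {i} → i ∈ s → Fin n′) → (∀ {i} (i∈s : i ∈ s) → f i∈s ∈ t) →
                (∀ {i j} (i∈s : i ∈ s) (j∈s : j ∈ s) → f i∈s ≡ f j∈s → i ≡ j) → ∣ s ∣ ≤ ∣ t ∣
injection⇒∣∣≤ {s = s} f f∈t f-injective =
  distinct⇒≤∣∣ (f ∘ enumerate-∈ s) (enumerate-injective s ∘ f-injective _ _) (f∈t ∘ enumerate-∈ s)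

injection-covers : (f : ∀ {i} → i ∈ s → Fin n′) → (∀ {i} (i∈s : i ∈ s) → f i∈s ∈ t) →
                   (∀ {i j} (i∈s : i ∈ s) (j∈s : j ∈ s) → f i∈s ≡ f j∈s → i ≡ j) → ∣ t ∣ ≤ ∣ s ∣ →
                   j ∈ t → ∃ λ i → Σ (i ∈ s) λ i∈s → f i∈s ≡ j
injection-covers {s = s} f f∈t f-injective ∣t∣≤∣s∣ j∈t
  with distinct-covers (f ∘ enumerate-∈ s) (enumerate-injective s ∘ f-injective _ _)
                       (f∈t ∘ enumerate-∈ s) ∣t∣≤∣s∣ j∈t
... | a , hit = enumerate s a , enumerate-∈ s a , hit

injection₂⇒*≤ : (f : ∀ {i i′} → i ∈ s → i′ ∈ s′ → Fin n′) →
                (∀ {i i′} (i∈s : i ∈ s) (i′∈s′ : i′ ∈ s′) → f i∈s i′∈s′ ∈ t) →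
                (∀ {i i′ j j′} (i∈s : i ∈ s) (i′∈s′ : i′ ∈ s′) (j∈s : j ∈ s) (j′∈s′ : j′ ∈ s′) →
                   f i∈s i′∈s′ ≡ f j∈s j′∈s′ → i ≡ j × i′ ≡ j′) →
                ∣ s ∣ * ∣ s′ ∣ ≤ ∣ t ∣
injection₂⇒*≤ {s = s} {s′ = s′} {n′ = n′} f f∈t f-injective = distinct⇒≤∣∣ g g-injective (λ c → f∈t _ _)
  where
  open Inverse (*↔× {∣ s ∣} {∣ s′ ∣})
    using () renaming (to to pair; from to unpair; strictlyInverseʳ to unpair-pair)
  g : Fin (∣ s ∣ * ∣ s′ ∣) → Fin n′
  g c = f (enumerate-∈ s (proj₁ (pair c))) (enumerate-∈ s′ (proj₂ (pair c)))
  g-injective : Injective _≡_ _≡_ g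
  g-injective {c} {d} eq with f-injective _ _ _ _ eq
  ... | eq₁ , eq₂ = begin
    c                ≡⟨ unpair-pair c ⟨
    unpair (pair c)  ≡⟨ cong unpair (cong₂ _,_ (enumerate-injective s eq₁) (enumerate-injective s′ eq₂)) ⟩
    unpair (pair d)  ≡⟨ unpair-pair d ⟩
    d                ∎
    where open ≡-Reasoning

x∈p─q⇒x∉q : x ∈ p ─ q → x ∉ q
x∈p─q⇒x∉q {p = inside ∷ p} {q = outside ∷ q} here        ()
x∈p─q⇒x∉q {p = _      ∷ p} {q = inside  ∷ q} (there x∈) (there x∈q) = x∈p─q⇒x∉q x∈ x∈q
x∈p─q⇒x∉q {p = _      ∷ p} {q = outside ∷ q} (there x∈) (there x∈q) = x∈p─q⇒x∉q x∈ x∈q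

x∈p-y⇒x≢y : x ∈ p - y → x ≢ y
x∈p-y⇒x≢y = x∉⁅y⁆⇒x≢y ∘ x∈p─q⇒x∉q

x∈p⇒⁅x⁆⊆p : x ∈ p → ⁅ x ⁆ ⊆ p
x∈p⇒⁅x⁆⊆p {x = x} x∈p y∈⁅x⁆ = subst (_∈ _) (sym (x∈⁅y⁆⇒x≡y x y∈⁅x⁆)) x∈p

p-x≡p-y⇒x≡y : x ∈ p → p - x ≡ p - y → x ≡ y
p-x≡p-y⇒x≡y {x = x} {y = y} x∈p p-x≡p-y with x ≟ᶠ y
... | yes x≡y = x≡y
... | no  x≢y = contradiction refl (x∈p-y⇒x≢y (subst (x ∈_) (sym p-x≡p-y) (x∈p∧x≢y⇒x∈p-y x∈p x≢y)))

x∈p⇒∣p-x∣+1≡∣p∣ : x ∈ p → ℕ.suc ∣ p - x ∣ ≡ ∣ p ∣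
x∈p⇒∣p-x∣+1≡∣p∣ {p = inside  ∷ p} here        = cong (ℕ.suc ∘ ∣_∣) (p─⊥≡p p)
x∈p⇒∣p-x∣+1≡∣p∣ {p = inside  ∷ p} (there x∈p) = cong ℕ.suc (x∈p⇒∣p-x∣+1≡∣p∣ x∈p)
x∈p⇒∣p-x∣+1≡∣p∣ {p = outside ∷ p} (there x∈p) = x∈p⇒∣p-x∣+1≡∣p∣ x∈p

x∉p⇒∣p∪⁅x⁆∣≡1+∣p∣ : x ∉ p → ∣ p ∪ ⁅ x ⁆ ∣ ≡ ℕ.suc ∣ p ∣
x∉p⇒∣p∪⁅x⁆∣≡1+∣p∣ {x = zero}  {p = inside  ∷ p} x∉p = contradiction here x∉p
x∉p⇒∣p∪⁅x⁆∣≡1+∣p∣ {x = zero}  {p = outside ∷ p} x∉p = cong (ℕ.suc ∘ ∣_∣) (∪-identityʳ p)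
x∉p⇒∣p∪⁅x⁆∣≡1+∣p∣ {x = suc x} {p = inside  ∷ p} x∉p = cong ℕ.suc (x∉p⇒∣p∪⁅x⁆∣≡1+∣p∣ (x∉p ∘ there))
x∉p⇒∣p∪⁅x⁆∣≡1+∣p∣ {x = suc x} {p = outside ∷ p} x∉p = x∉p⇒∣p∪⁅x⁆∣≡1+∣p∣ (x∉p ∘ there)

q⊆p⇒∣p∣≡∣q∣+∣p─q∣ : {p q : Subset n} → q ⊆ p → ∣ p ∣ ≡ ∣ q ∣ + ∣ p ─ q ∣
q⊆p⇒∣p∣≡∣q∣+∣p─q∣ {p = []}          {q = []}          _   = refl
q⊆p⇒∣p∣≡∣q∣+∣p─q∣ {p = inside  ∷ p} {q = inside  ∷ q} q⊆p = cong ℕ.suc (q⊆p⇒∣p∣≡∣q∣+∣p─q∣ (drop-∷-⊆ q⊆p))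
q⊆p⇒∣p∣≡∣q∣+∣p─q∣ {p = inside  ∷ p} {q = outside ∷ q} q⊆p =
  trans (cong ℕ.suc (q⊆p⇒∣p∣≡∣q∣+∣p─q∣ (drop-∷-⊆ q⊆p))) (sym (+-suc ∣ q ∣ ∣ p ─ q ∣))
q⊆p⇒∣p∣≡∣q∣+∣p─q∣ {p = outside ∷ p} {q = inside  ∷ q} q⊆p = contradiction (q⊆p here) λ ()
q⊆p⇒∣p∣≡∣q∣+∣p─q∣ {p = outside ∷ p} {q = outside ∷ q} q⊆p = q⊆p⇒∣p∣≡∣q∣+∣p─q∣ (drop-∷-⊆ q⊆p)

p⊆q∧∣q∣≤∣p∣⇒p≡q : p ⊆ q → ∣ q ∣ ≤ ∣ p ∣ → p ≡ q
p⊆q∧∣q∣≤∣p∣⇒p≡q {p = []}          {q = []}          _   _ = refl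
p⊆q∧∣q∣≤∣p∣⇒p≡q {p = inside  ∷ p} {q = inside  ∷ q} p⊆q ∣q∣≤∣p∣ =
  cong (inside ∷_) (p⊆q∧∣q∣≤∣p∣⇒p≡q (drop-∷-⊆ p⊆q) (≤-pred ∣q∣≤∣p∣))
p⊆q∧∣q∣≤∣p∣⇒p≡q {p = inside  ∷ p} {q = outside ∷ q} p⊆q ∣q∣≤∣p∣ = contradiction (p⊆q here) λ ()
p⊆q∧∣q∣≤∣p∣⇒p≡q {p = outside ∷ p} {q = inside  ∷ q} p⊆q ∣q∣≤∣p∣ =
  contradiction (≤-trans ∣q∣≤∣p∣ (p⊆q⇒∣p∣≤∣q∣ (drop-∷-⊆ p⊆q))) (<⇒≱ ≤-refl)
p⊆q∧∣q∣≤∣p∣⇒p≡q {p = outside ∷ p} {q = outside ∷ q} p⊆q ∣q∣≤∣p∣ =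
  cong (outside ∷_) (p⊆q∧∣q∣≤∣p∣⇒p≡q (drop-∷-⊆ p⊆q) ∣q∣≤∣p∣)

∃-∈-avoiding : (p : Subset n) (xs : List (Fin n)) → length xs < ∣ p ∣ → ∃ λ i → i ∈ p × All (i ≢_) xs
∃-∈-avoiding {n = n} p [] 0<∣p∣ with nonempty? p
... | yes (i , i∈p) = i , i∈p , []
... | no  empty     = contradiction (trans (cong ∣_∣ (Empty-unique empty)) (∣⊥∣≡0 n)) (>⇒≢ 0<∣p∣)
∃-∈-avoiding p (x ∷ xs) ∣xs∣<∣p∣ with x ∈? p
... | yes x∈p =
  let i , i∈p-x , i∉xs = ∃-∈-avoiding (p - x) xs (≤-pred (subst (_ <_) (sym (x∈p⇒∣p-x∣+1≡∣p∣ x∈p)) ∣xs∣<∣p∣))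
  in i , p─q⊆p p ⁅ x ⁆ i∈p-x , x∈p-y⇒x≢y i∈p-x ∷ i∉xs
... | no x∉p =
  let i , i∈p , i∉xs = ∃-∈-avoiding p xs (<-trans (n<1+n _) ∣xs∣<∣p∣)
  in i , i∈p , (λ { refl → x∉p i∈p }) ∷ i∉xs

∃-distinct-pair : 2 ≤ ∣ p ∣ → ∃ λ i → ∃ λ j → i ∈ p × j ∈ p × i ≢ j
∃-distinct-pair {p = p} 2≤∣p∣ with ∃-∈-avoiding p [] (≤-trans (s≤s z≤n) 2≤∣p∣)
... | i , i∈p , _ with ∃-∈-avoiding p (i ∷ []) 2≤∣p∣
...   | j , j∈p , j≢i ∷ [] = i , j , i∈p , j∈p , j≢i ∘ sym

∃-⊆-between : r ⊆ p → ∣ r ∣ ≤ k → k ≤ ∣ p ∣ → ∃ λ q → r ⊆ q × q ⊆ p × ∣ q ∣ ≡ k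
∃-⊆-between {r = []} {p = []} _ z≤n z≤n = [] , (λ ()) , (λ ()) , refl
∃-⊆-between {r = inside ∷ r} {p = inside ∷ p} {k = ℕ.suc k} r⊆p (s≤s ∣r∣≤k) (s≤s k≤∣p∣) =
  let q , r⊆q , q⊆p , ∣q∣≡k = ∃-⊆-between (drop-∷-⊆ r⊆p) ∣r∣≤k k≤∣p∣
  in inside ∷ q , in⊆in r⊆q , in⊆in q⊆p , cong ℕ.suc ∣q∣≡k
∃-⊆-between {r = inside ∷ r} {p = outside ∷ p} r⊆p _ _ = contradiction (r⊆p here) λ ()
∃-⊆-between {r = outside ∷ r} {p = outside ∷ p} r⊆p ∣r∣≤k k≤∣p∣ =
  let q , r⊆q , q⊆p , ∣q∣≡k = ∃-⊆-between (drop-∷-⊆ r⊆p) ∣r∣≤k k≤∣p∣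
  in outside ∷ q , s⊆s r⊆q , s⊆s q⊆p , ∣q∣≡k
∃-⊆-between {r = outside ∷ r} {p = inside ∷ p} {k = k} r⊆p ∣r∣≤k k≤1+∣p∣ with k ≤? ∣ p ∣
... | yes k≤∣p∣ =
  let q , r⊆q , q⊆p , ∣q∣≡k = ∃-⊆-between (drop-∷-⊆ r⊆p) ∣r∣≤k k≤∣p∣
  in outside ∷ q , s⊆s r⊆q , out⊆ q⊆p , ∣q∣≡k
... | no k≰∣p∣ with k | k≤1+∣p∣
...   | ℕ.zero   | z≤n        = contradiction z≤n k≰∣p∣
...   | ℕ.suc k′ | s≤s k′≤∣p∣ =
  let q , r⊆q , q⊆p , ∣q∣≡k′ =
        ∃-⊆-between (drop-∷-⊆ r⊆p) (≤-trans (p⊆q⇒∣p∣≤∣q∣ (drop-∷-⊆ r⊆p)) (≮⇒≥ k≰∣p∣)) k′≤∣p∣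
  in inside ∷ q , out⊆ r⊆q , in⊆in q⊆p , cong ℕ.suc ∣q∣≡k′

exchange : Subset n → Fin n → Fin n → Subset n
exchange p x y = (p - x) ∪ ⁅ y ⁆

∈-exchange-new : y ∈ exchange p x y
∈-exchange-new {y = y} {p = p} {x = x} = q⊆p∪q (p - x) ⁅ y ⁆ (x∈⁅x⁆ y)

∈-exchange-kept : i ∈ p → i ≢ x → i ∈ exchange p x y
∈-exchange-kept i∈p i≢x = p⊆p∪q _ (x∈p∧x≢y⇒x∈p-y i∈p i≢x)

∈-exchange⁻ : i ∈ exchange p x y → i ≡ y ⊎ (i ∈ p × i ≢ x)
∈-exchange⁻ {p = p} {x = x} {y = y} i∈ with x∈p∪q⁻ (p - x) ⁅ y ⁆ i∈
... | inj₁ i∈p-x = inj₂ (p─q⊆p p ⁅ x ⁆ i∈p-x , x∈p-y⇒x≢y i∈p-x)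
... | inj₂ i∈⁅y⁆ = inj₁ (x∈⁅y⁆⇒x≡y y i∈⁅y⁆)

exchange⊆ : p ⊆ q → y ∈ q → exchange p x y ⊆ q
exchange⊆ p⊆q y∈q i∈ with ∈-exchange⁻ i∈
... | inj₁ refl      = y∈q
... | inj₂ (i∈p , _) = p⊆q i∈p

∣exchange∣ : x ∈ p → y ∉ p → ∣ exchange p x y ∣ ≡ ∣ p ∣
∣exchange∣ {x = x} {p = p} x∈p y∉p =
  trans (x∉p⇒∣p∪⁅x⁆∣≡1+∣p∣ (y∉p ∘ p─q⊆p p ⁅ x ⁆)) (x∈p⇒∣p-x∣+1≡∣p∣ x∈p)

exchange-injective : x ∈ p → y ∉ p → x′ ∈ p → y′ ∉ p → exchange p x y ≡ exchange p x′ y′ → x ≡ x′ × y ≡ y′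
exchange-injective {x = x} {y = y} {x′ = x′} {y′ = y′} x∈p y∉p x′∈p y′∉p same = x≡x′ , y≡y′
  where
  x≡x′ : x ≡ x′
  x≡x′ with x ≟ᶠ x′
  ... | yes x≡x′ = x≡x′
  ... | no  x≢x′ with ∈-exchange⁻ (subst (x ∈_) (sym same) (∈-exchange-kept x∈p x≢x′))
  ...   | inj₁ refl      = contradiction x∈p y∉p
  ...   | inj₂ (_ , x≢x) = contradiction refl x≢x
  y≡y′ : y ≡ y′
  y≡y′ with ∈-exchange⁻ (subst (y ∈_) same ∈-exchange-new)
  ... | inj₁ y≡y′     = y≡y′
  ... | inj₂ (y∈p , _) = contradiction y∈p y∉p

ω+t<ω*t : ∀ {ω t} → 3 ≤ ω → 2 ≤ t → ω + t < ω * t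
ω+t<ω*t {ω@(ℕ.suc _)} {ℕ.suc (ℕ.suc b)} 3≤ω (s≤s (s≤s z≤n)) = begin-strict
  ω + (2 + b)        <⟨ +-monoʳ-< ω (+-monoˡ-< b 3≤ω) ⟩
  ω + (ω + b)        ≤⟨ +-monoʳ-≤ ω (+-monoʳ-≤ ω (m≤n*m b ω)) ⟩
  ω + (ω + ω * b)    ≡⟨ cong (ω +_) (*-suc ω b) ⟨
  ω + ω * ℕ.suc b    ≡⟨ *-suc ω (ℕ.suc b) ⟨
  ω * (2 + b)        ∎
  where open ≤-Reasoning

-- Cliques of a graph

PairwiseAdjacent : (G : Graph) → Subset (size G) → Set
PairwiseAdjacent G s = ∀ {i j} → i ∈ s → j ∈ s → i ≢ j → Adj G i j

isCliqueᵇ⇔ : (G : Graph) (ω : ℕ) (s : Subset (size G)) →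
             T (isCliqueᵇ G ω s) ⇔ (∣ s ∣ ≡ ω × PairwiseAdjacent G s)
isCliqueᵇ⇔ G ω s = mk⇔
  (λ h → let size≡ , adjacent = to T-∧ h in
    ≡ᵇ⇒≡ _ _ size≡ ,
    λ {i} {j} i∈s j∈s i≢j → to (T-implication _ _ _ _) (to allFin-all⇔ (to allFin-all⇔ adjacent i) j)
      (to ∈⇔T-lookup i∈s) (to ∈⇔T-lookup j∈s) (i≢j ∘ to (T-does (i ≟ᶠ j))))
  (λ (size≡ , adjacent) → from T-∧ (≡⇒≡ᵇ _ _ size≡ ,
    from allFin-all⇔ λ i → from allFin-all⇔ λ j → from (T-implication _ _ _ _)
      λ i∈s j∈s i≢j → adjacent (from ∈⇔T-lookup i∈s) (from ∈⇔T-lookup j∈s) (i≢j ∘ from (T-does (i ≟ᶠ j)))))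

lookup-injective : {A : Set} {xs : List A} → Unique xs → Injective _≡_ _≡_ (List.lookup xs)
lookup-injective {xs = x List.∷ xs} _ {zero} {zero} _ = refl
lookup-injective {xs = x List.∷ xs} (x∉xs AllPairs.∷ _) {zero} {suc j} eq =
  contradiction eq (All.lookup x∉xs (Listₚ.∈-lookup j))
lookup-injective {xs = x List.∷ xs} (x∉xs AllPairs.∷ _) {suc i} {zero} eq =
  contradiction (sym eq) (All.lookup x∉xs (Listₚ.∈-lookup i))
lookup-injective {xs = x List.∷ xs} (_ AllPairs.∷ unique) {suc i} {suc j} eq =
  cong suc (lookup-injective unique eq)

∈-allSubsets : (s : Subset n) → s ∈ₗ allSubsets n
∈-allSubsets []            = Any.here refl
∈-allSubsets (inside  ∷ s) = Listₚ.∈-++⁺ˡ (Listₚ.∈-map⁺ (inside ∷_) (∈-allSubsets s))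
∈-allSubsets (outside ∷ s) = Listₚ.∈-++⁺ʳ _ (Listₚ.∈-map⁺ (outside ∷_) (∈-allSubsets s))

allSubsets-unique : ∀ n → Unique (allSubsets n)
allSubsets-unique ℕ.zero    = All.[] AllPairs.∷ AllPairs.[]
allSubsets-unique (ℕ.suc n) = Unique.++⁺ (Unique.map⁺ ∷-injectiveʳ (allSubsets-unique n))
  (Unique.map⁺ ∷-injectiveʳ (allSubsets-unique n)) heads-differ
  where
  heads-differ : ∀ {s} → ¬ (s ∈ₗ List.map (inside ∷_) (allSubsets n) × s ∈ₗ List.map (outside ∷_) (allSubsets n))
  heads-differ (s∈ins , s∈outs) with Listₚ.∈-map⁻ (inside ∷_) s∈ins | Listₚ.∈-map⁻ (outside ∷_) s∈outs
  ... | _ , _ , refl | _ , _ , ()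

module CliqueGraph (ω : ℕ) (H : Graph) where

  C : Graph
  C = cliqueGraph ω H

  K : Set
  K = Fin (size C)

  clique : K → Subset (size H)
  clique = List.lookup (cliques H ω)

  clique-valid : ∀ a → ∣ clique a ∣ ≡ ω × PairwiseAdjacent H (clique a)
  clique-valid a = to (isCliqueᵇ⇔ H ω (clique a))
    (proj₂ (Listₚ.∈-filter⁻ (T? ∘ isCliqueᵇ H ω) {xs = allSubsets _} (Listₚ.∈-lookup a)))

  clique-injective : Injective _≡_ _≡_ clique
  clique-injective = lookup-injective (Unique.filter⁺ (T? ∘ isCliqueᵇ H ω) (allSubsets-unique _))

  opaque
    clique-complete : ∀ {s} → ∣ s ∣ ≡ ω → PairwiseAdjacent H s → ∃ λ a → clique a ≡ s
    clique-complete {s} ∣s∣≡ω adjacent = Any.index s∈cliques , sym (Any.lookup-index s∈cliques)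
      where
      s∈cliques : s ∈ₗ cliques H ω
      s∈cliques = Listₚ.∈-filter⁺ (T? ∘ isCliqueᵇ H ω) (∈-allSubsets s) (from (isCliqueᵇ⇔ H ω s) (∣s∣≡ω , adjacent))

  adj-cliqueGraph⇔ : ∀ {a b} → Adj C a b ⇔ (clique a ≢ clique b × Nonempty (clique a ∩ clique b))
  adj-cliqueGraph⇔ {a} {b} = mk⇔
    (λ h → let ≢ , meet = to T-∧ h in
      to (T-not-does (≡-dec _≟ᵇ_ _ _)) ≢ , to (T-nonemptyᵇ _) meet)
    (λ (≢ , meet) → from T-∧ (from (T-not-does (≡-dec _≟ᵇ_ _ _)) ≢ , from (T-nonemptyᵇ _) meet))

injectiveHomomorphism⇒degree≤ : (G H : Graph) (f : Fin (size G) → Fin (size H)) → Injective _≡_ _≡_ f →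
  (∀ {i j} → Adj G i j → Adj H (f i) (f j)) → ∀ i → degree G i ≤ degree H (f i)
injectiveHomomorphism⇒degree≤ G H f f-injective f-homomorphism i =
  injection⇒∣∣≤ {t = tabulate (adj H (f i))} (λ {j} _ → f j)
    (from ∈-tabulate ∘ f-homomorphism ∘ to ∈-tabulate) (λ _ _ → f-injective)

-- Edges and stars of a simple graph

module Edges (Γ : Graph) (simple : IsSimple Γ) where
  open IsSimple simple renaming (sym to adj-sym; irrefl to adj-irrefl)

  V : Set
  V = Fin (size Γ)

  L : Graph
  L = lineGraph Γ

  E : Set
  E = Fin (size L)

  private
    variable
      u v w : V
      e f : E

  Adj-sym : Adj Γ u v → Adj Γ v u
  Adj-sym {u} {v} = subst T (adj-sym u v)

  Adj⇒≢ : Adj Γ u v → u ≢ v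
  Adj⇒≢ {u} u~u refl = subst T (adj-irrefl u) u~u

  ends : E → V × V
  ends = List.lookup (edges Γ)

  oriented : V × V → Bool
  oriented (a , b) = (toℕ a <ᵇ toℕ b) ∧ adj Γ a b

  ends-oriented : ∀ e → toℕ (proj₁ (ends e)) < toℕ (proj₂ (ends e)) × Adj Γ (proj₁ (ends e)) (proj₂ (ends e))
  ends-oriented e =
    let _ , h = Listₚ.∈-filter⁻ (T? ∘ oriented) {xs = cartesianProduct (allFin _) (allFin _)} (Listₚ.∈-lookup e)
        a<b , a~b = to T-∧ h
    in <ᵇ⇒< _ _ a<b , a~b

  ends-injective : Injective _≡_ _≡_ ends
  ends-injective = lookup-injective (Unique.filter⁺ (T? ∘ oriented)
    (Unique.cartesianProductWith⁺ _,_ (λ { refl → refl , refl }) (Unique.allFin⁺ _) (Unique.allFin⁺ _)))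

  edge-with-ends : ∀ a b → toℕ a < toℕ b → Adj Γ a b → ∃ λ e → ends e ≡ (a , b)
  edge-with-ends a b a<b a~b = Any.index ab∈edges , sym (Any.lookup-index ab∈edges)
    where
    ab∈edges = Listₚ.∈-filter⁺ (T? ∘ oriented)
      (Listₚ.∈-cartesianProduct⁺ (Listₚ.∈-allFin a) (Listₚ.∈-allFin b)) (from T-∧ (<⇒<ᵇ a<b , a~b))

  _∈ᵉ_ : V → E → Set
  v ∈ᵉ e = v ≡ proj₁ (ends e) ⊎ v ≡ proj₂ (ends e)

  _∈ᵉ?_ : ∀ v e → Dec (v ∈ᵉ e)
  v ∈ᵉ? e = (v ≟ᶠ proj₁ (ends e)) ⊎-dec (v ≟ᶠ proj₂ (ends e))

  opaque
    star : V → Subset (size L)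
    star v = tabulate (λ e → does (v ∈ᵉ? e))

    ∈-star⁺ : v ∈ᵉ e → e ∈ star v
    ∈-star⁺ {v} {e} = from ∈-tabulate ∘ from (T-does (v ∈ᵉ? e))

    ∈-star⁻ : ∀ v → e ∈ star v → v ∈ᵉ e
    ∈-star⁻ {e} v = to (T-does (v ∈ᵉ? e)) ∘ to ∈-tabulate

  orientation : u ≢ v → u ∈ᵉ e → v ∈ᵉ e →
                (ends e ≡ (u , v) × toℕ u < toℕ v) ⊎ (ends e ≡ (v , u) × toℕ v < toℕ u)
  orientation u≢v (inj₁ refl) (inj₁ refl) = contradiction refl u≢v
  orientation u≢v (inj₂ refl) (inj₂ refl) = contradiction refl u≢v
  orientation {e = e} _ (inj₁ refl) (inj₂ refl) = inj₁ (refl , proj₁ (ends-oriented e))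
  orientation {e = e} _ (inj₂ refl) (inj₁ refl) = inj₂ (refl , proj₁ (ends-oriented e))

  edge-unique : u ≢ v → u ∈ᵉ e → v ∈ᵉ e → u ∈ᵉ f → v ∈ᵉ f → e ≡ f
  edge-unique u≢v u∈e v∈e u∈f v∈f with orientation u≢v u∈e v∈e | orientation u≢v u∈f v∈f
  ... | inj₁ (e≡uv , _)   | inj₁ (f≡uv , _)   = ends-injective (trans e≡uv (sym f≡uv))
  ... | inj₂ (e≡vu , _)   | inj₂ (f≡vu , _)   = ends-injective (trans e≡vu (sym f≡vu))
  ... | inj₁ (_ , u<v)    | inj₂ (_ , v<u)    = contradiction u<v (<-asym v<u)
  ... | inj₂ (_ , v<u)    | inj₁ (_ , u<v)    = contradiction u<v (<-asym v<u)

  third-endpoint : u ≢ v → u ∈ᵉ e → v ∈ᵉ e → w ∈ᵉ e → w ≢ u → w ≡ v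
  third-endpoint u≢v (inj₁ refl) (inj₁ refl) _ _ = contradiction refl u≢v
  third-endpoint u≢v (inj₂ refl) (inj₂ refl) _ _ = contradiction refl u≢v
  third-endpoint _ (inj₁ refl) (inj₂ refl) (inj₁ refl) w≢u = contradiction refl w≢u
  third-endpoint _ (inj₁ refl) (inj₂ refl) (inj₂ refl) _   = refl
  third-endpoint _ (inj₂ refl) (inj₁ refl) (inj₁ refl) _   = refl
  third-endpoint _ (inj₂ refl) (inj₁ refl) (inj₂ refl) w≢u = contradiction refl w≢u

  endpoints-adjacent : u ≢ v → u ∈ᵉ e → v ∈ᵉ e → Adj Γ u v
  endpoints-adjacent {e = e} u≢v u∈e v∈e with orientation u≢v u∈e v∈e
  ... | inj₁ (refl , _) = proj₂ (ends-oriented e)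
  ... | inj₂ (refl , _) = Adj-sym (proj₂ (ends-oriented e))

  edge-between : Adj Γ u v → ∃ λ e → u ∈ᵉ e × v ∈ᵉ e
  edge-between {u} {v} u~v with <-cmp (toℕ u) (toℕ v)
  ... | tri< u<v _ _ = let e , e≡uv = edge-with-ends u v u<v u~v
                       in e , inj₁ (cong proj₁ (sym e≡uv)) , inj₂ (cong proj₂ (sym e≡uv))
  ... | tri≈ _ u≡v _ = contradiction (toℕ-injective u≡v) (Adj⇒≢ u~v)
  ... | tri> _ _ v<u = let e , e≡vu = edge-with-ends v u v<u (Adj-sym u~v)
                       in e , inj₂ (cong proj₂ (sym e≡vu)) , inj₁ (cong proj₁ (sym e≡vu))

  opposite : v ∈ᵉ e → V
  opposite {e = e} (inj₁ _) = proj₂ (ends e)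
  opposite {e = e} (inj₂ _) = proj₁ (ends e)

  opposite-∈ᵉ : (v∈e : v ∈ᵉ e) → opposite v∈e ∈ᵉ e
  opposite-∈ᵉ (inj₁ _) = inj₂ refl
  opposite-∈ᵉ (inj₂ _) = inj₁ refl

  opposite-adjacent : (v∈e : v ∈ᵉ e) → Adj Γ v (opposite v∈e)
  opposite-adjacent {e = e} (inj₁ refl) = proj₂ (ends-oriented e)
  opposite-adjacent {e = e} (inj₂ refl) = Adj-sym (proj₂ (ends-oriented e))

  ∣star∣≡degree : ∀ v → ∣ star v ∣ ≡ degree Γ v
  ∣star∣≡degree v = ≤-antisym
    (injection⇒∣∣≤ {t = tabulate (adj Γ v)} far (from ∈-tabulate ∘ opposite-adjacent ∘ ∈-star⁻ v) far-injective)
    (injection⇒∣∣≤ {t = star v} edge-to (∈-star⁺ ∘ proj₁ ∘ proj₂ ∘ edge-between ∘ to ∈-tabulate) edge-to-injective)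
    where
    far : e ∈ star v → V
    far = opposite ∘ ∈-star⁻ v
    far-injective : (e∈ : e ∈ star v) (f∈ : f ∈ star v) → far e∈ ≡ far f∈ → e ≡ f
    far-injective e∈ f∈ same = edge-unique (Adj⇒≢ (opposite-adjacent v∈e))
      v∈e (opposite-∈ᵉ v∈e) (∈-star⁻ v f∈) (subst (_∈ᵉ _) (sym same) (opposite-∈ᵉ (∈-star⁻ v f∈)))
      where v∈e = ∈-star⁻ v e∈
    edge-to : u ∈ tabulate (adj Γ v) → E
    edge-to = proj₁ ∘ edge-between ∘ to ∈-tabulate
    edge-to-injective : (u∈ : u ∈ tabulate (adj Γ v)) (w∈ : w ∈ tabulate (adj Γ v)) → edge-to u∈ ≡ edge-to w∈ → u ≡ w
    edge-to-injective {w = w} u∈ w∈ same with edge-between (to ∈-tabulate u∈) | edge-between (to ∈-tabulate w∈)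
    ... | e , v∈e , u∈e | f , _ , w∈f = sym (third-endpoint (Adj⇒≢ (to ∈-tabulate u∈)) v∈e u∈e
      (subst (w ∈ᵉ_) (sym same) w∈f) (Adj⇒≢ (to ∈-tabulate w∈) ∘ sym))

module LineGraph (Γ : Graph) (simple : IsSimple Γ) where
  open Edges Γ simple public

  private
    variable
      b b′ c v : V
      e e₁ e₂ f g h : E

  Meet : E → E → Set
  Meet e f = ∃ λ v → v ∈ᵉ e × v ∈ᵉ f

  adj-lineGraph⇔ : Adj L e f ⇔ (e ≢ f × Meet e f)
  adj-lineGraph⇔ {e} {f} = mk⇔
    (λ h → let e≢f , meet = to T-∧ h in to (T-not-does (e ≟ᶠ f)) e≢f , to (shareEndpoint⇔ (ends e) (ends f)) meet)
    (λ (e≢f , meet) → from T-∧ (from (T-not-does (e ≟ᶠ f)) e≢f , from (shareEndpoint⇔ (ends e) (ends f)) meet))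

  -- The edges cb, cb′ and bb′ of a triangle have no fourth edge meeting all three.
  triangle-unmeetable : e₁ ≢ e₂ → c ∈ᵉ e₁ → c ∈ᵉ e₂ → b ∈ᵉ e₁ → b ∈ᵉ g → b′ ∈ᵉ e₂ → b′ ∈ᵉ g → ¬ c ∈ᵉ g →
                        Meet h e₁ → Meet h e₂ → Meet h g → h ≢ e₁ → h ≢ e₂ → h ≢ g → ⊥
  triangle-unmeetable {c = c} {b = b} {b′ = b′} {h = h}
    e₁≢e₂ c∈e₁ c∈e₂ b∈e₁ b∈g b′∈e₂ b′∈g c∉g (z , z∈h , z∈e₁) (z′ , z′∈h , z′∈e₂) (w , w∈h , w∈g) h≢e₁ h≢e₂ h≢g
    = by-cases (c ∈ᵉ? h)
    where
    c≢b : c ≢ b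
    c≢b refl = c∉g b∈g
    c≢b′ : c ≢ b′
    c≢b′ refl = c∉g b′∈g
    b≢b′ : b ≢ b′
    b≢b′ refl = e₁≢e₂ (edge-unique c≢b c∈e₁ b∈e₁ c∈e₂ b′∈e₂)
    by-cases : Dec (c ∈ᵉ h) → ⊥
    by-cases (yes c∈h) with w ≟ᶠ b
    ... | yes refl = h≢e₁ (edge-unique c≢b c∈h w∈h c∈e₁ b∈e₁)
    ... | no  w≢b  = h≢e₂ (edge-unique c≢b′ c∈h (subst (_∈ᵉ h) (third-endpoint b≢b′ b∈g b′∈g w∈g w≢b) w∈h) c∈e₂ b′∈e₂)
    by-cases (no c∉h) = h≢g (edge-unique b≢b′ b∈h b′∈h b∈g b′∈g)
      where
      b∈h : b ∈ᵉ h
      b∈h = subst (_∈ᵉ h) (third-endpoint (c≢b) c∈e₁ b∈e₁ z∈e₁ λ { refl → c∉h z∈h }) z∈h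
      b′∈h : b′ ∈ᵉ h
      b′∈h = subst (_∈ᵉ h) (third-endpoint (c≢b′) c∈e₂ b′∈e₂ z′∈e₂ λ { refl → c∉h z′∈h }) z′∈h

  meet : PairwiseAdjacent L s → e ∈ s → f ∈ s → e ≢ f → Meet e f
  meet adjacent e∈s f∈s e≢f = proj₂ (to adj-lineGraph⇔ (adjacent e∈s f∈s e≢f))

  common-vertex : PairwiseAdjacent L s → 4 ≤ ∣ s ∣ → ∃ λ c → s ⊆ star c
  common-vertex {s = s} adjacent 4≤∣s∣ with ∃-distinct-pair (≤-trans (s≤s (s≤s z≤n)) 4≤∣s∣)
  ... | e₁ , e₂ , e₁∈s , e₂∈s , e₁≢e₂ with meet adjacent e₁∈s e₂∈s e₁≢e₂
  ...   | c , c∈e₁ , c∈e₂ = c , ∈-star⁺ ∘ through-c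
    where
    through-c : g ∈ s → c ∈ᵉ g
    through-c {g} g∈s with c ∈ᵉ? g | ∃-∈-avoiding s (e₁ ∷ e₂ ∷ g ∷ []) 4≤∣s∣
    ... | yes c∈g | _ = c∈g
    ... | no  c∉g | h , h∈s , h≢e₁ ∷ h≢e₂ ∷ h≢g ∷ [] =
      let b  , b∈g  , b∈e₁  = meet adjacent g∈s e₁∈s λ { refl → c∉g c∈e₁ }
          b′ , b′∈g , b′∈e₂ = meet adjacent g∈s e₂∈s λ { refl → c∉g c∈e₂ }
      in ⊥-elim (triangle-unmeetable e₁≢e₂ c∈e₁ c∈e₂ b∈e₁ b∈g b′∈e₂ b′∈g c∉g
           (meet adjacent h∈s e₁∈s h≢e₁) (meet adjacent h∈s e₂∈s h≢e₂) (meet adjacent h∈s g∈s h≢g) h≢e₁ h≢e₂ h≢g)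

  ⊆star⇒pairwiseAdjacent : ∀ v → s ⊆ star v → PairwiseAdjacent L s
  ⊆star⇒pairwiseAdjacent v s⊆star e∈s f∈s e≢f =
    from adj-lineGraph⇔ (e≢f , v , ∈-star⁻ v (s⊆star e∈s) , ∈-star⁻ v (s⊆star f∈s))

  centre-unique : 2 ≤ ∣ s ∣ → s ⊆ star b → s ⊆ star c → b ≡ c
  centre-unique {b = b} {c = c} 2≤∣s∣ s⊆b s⊆c with b ≟ᶠ c | ∃-distinct-pair 2≤∣s∣
  ... | yes b≡c | _ = b≡c
  ... | no  b≢c | e₁ , e₂ , e₁∈s , e₂∈s , e₁≢e₂ = contradiction
    (edge-unique b≢c (∈-star⁻ b (s⊆b e₁∈s)) (∈-star⁻ c (s⊆c e₁∈s)) (∈-star⁻ b (s⊆b e₂∈s)) (∈-star⁻ c (s⊆c e₂∈s)))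
    e₁≢e₂

-- ω-cliques of the line graph

module Cliques (ω : ℕ) (4≤ω : 4 ≤ ω) (Γ : Graph) (simple : IsSimple Γ) where
  open LineGraph Γ simple public
  open CliqueGraph ω L public

  private
    variable
      a b : K
      u v : V
      e f : E

  ∣clique∣≡ω : ∀ a → ∣ clique a ∣ ≡ ω
  ∣clique∣≡ω = proj₁ ∘ clique-valid

  2≤ω : 2 ≤ ω
  2≤ω = ≤-trans (s≤s (s≤s z≤n)) 4≤ω

  2≤∣clique∣ : ∀ a → 2 ≤ ∣ clique a ∣
  2≤∣clique∣ a = subst (2 ≤_) (sym (∣clique∣≡ω a)) 2≤ω

  opaque
    centred : ∀ a → ∃ λ c → clique a ⊆ star c
    centred a = common-vertex (proj₂ (clique-valid a)) (subst (4 ≤_) (sym (∣clique∣≡ω a)) 4≤ω)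

  centre : K → V
  centre = proj₁ ∘ centred

  clique⊆star-centre : ∀ a → clique a ⊆ star (centre a)
  clique⊆star-centre = proj₂ ∘ centred

  clique-in-star : ∀ v → s ⊆ star v → ∣ s ∣ ≡ ω → ∃ λ a → clique a ≡ s
  clique-in-star v s⊆star ∣s∣≡ω = clique-complete ∣s∣≡ω (⊆star⇒pairwiseAdjacent v s⊆star)

  clique≡star-centre : degree Γ (centre a) ≤ ω → clique a ≡ star (centre a)
  clique≡star-centre {a} deg≤ω = p⊆q∧∣q∣≤∣p∣⇒p≡q (clique⊆star-centre a)
    (subst₂ _≤_ (sym (∣star∣≡degree (centre a))) (sym (∣clique∣≡ω a)) deg≤ω)

  cliques-in-distinct-stars : clique a ⊆ star u → clique b ⊆ star v → u ≢ v → clique a ≢ clique b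
  cliques-in-distinct-stars {a} {v = v} a⊆u b⊆v u≢v a≡b =
    u≢v (centre-unique (2≤∣clique∣ a) a⊆u (subst (_⊆ star v) (sym a≡b) b⊆v))

  clique-through : ω ≤ degree Γ v → e ∈ star v → ∃ λ a → clique a ⊆ star v × e ∈ clique a
  clique-through {v} {e} ω≤deg e∈star
    with ∃-⊆-between (x∈p⇒⁅x⁆⊆p e∈star) (≤-trans (≤-reflexive (∣⁅x⁆∣≡1 e)) (≤-trans (s≤s z≤n) 4≤ω))
                     (subst (ω ≤_) (sym (∣star∣≡degree v)) ω≤deg)
  ... | S , ⁅e⁆⊆S , S⊆star , ∣S∣≡ω with clique-in-star v S⊆star ∣S∣≡ω
  ...   | a , refl = a , S⊆star , ⁅e⁆⊆S (x∈⁅x⁆ e)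

  sharing-cliques-adjacent : clique a ≢ clique b → e ∈ clique a → e ∈ clique b → Adj C a b
  sharing-cliques-adjacent a≢b e∈a e∈b = from adj-cliqueGraph⇔ (a≢b , _ , x∈p∩q⁺ (e∈a , e∈b))

  module Removals (v₀ : V) (deg≡1+ω : degree Γ v₀ ≡ ℕ.suc ω) where

    P : Subset (size L)
    P = star v₀

    ∣P∣≡1+ω : ∣ P ∣ ≡ ℕ.suc ω
    ∣P∣≡1+ω = trans (∣star∣≡degree v₀) deg≡1+ω

    2<∣P∣ : 2 < ∣ P ∣
    2<∣P∣ = subst (2 <_) (sym ∣P∣≡1+ω) (s≤s 2≤ω)

    ∣P-e∣≡ω : e ∈ P → ∣ P - e ∣ ≡ ω
    ∣P-e∣≡ω e∈P = suc-injective (trans (x∈p⇒∣p-x∣+1≡∣p∣ e∈P) ∣P∣≡1+ω)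

    removal-is-clique : e ∈ P → ∃ λ a → clique a ≡ P - e
    removal-is-clique e∈P = clique-in-star v₀ (p─q⊆p _ _) (∣P-e∣≡ω e∈P)

    removal : e ∈ P → K
    removal = proj₁ ∘ removal-is-clique

    clique-removal : (e∈P : e ∈ P) → clique (removal e∈P) ≡ P - e
    clique-removal = proj₂ ∘ removal-is-clique

    removal⊆star : (e∈P : e ∈ P) → clique (removal e∈P) ⊆ star v₀
    removal⊆star e∈P = subst (_⊆ P) (sym (clique-removal e∈P)) (p─q⊆p _ _)

    removal-injective : (e∈P : e ∈ P) (f∈P : f ∈ P) → removal e∈P ≡ removal f∈P → e ≡ f
    removal-injective e∈P f∈P same = p-x≡p-y⇒x≡y e∈P
      (trans (sym (clique-removal e∈P)) (trans (cong clique same) (clique-removal f∈P)))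

    removal-adjacent : (e∈P : e ∈ P) (f∈P : f ∈ P) → e ≢ f → Adj C (removal e∈P) (removal f∈P)
    removal-adjacent {e} {f} e∈P f∈P e≢f =
      let b , b∈P , b≢ = ∃-∈-avoiding P (e ∷ f ∷ []) 2<∣P∣
      in sharing-cliques-adjacent (e≢f ∘ removal-injective e∈P f∈P ∘ clique-injective)
        (subst (b ∈_) (sym (clique-removal e∈P)) (x∈p∧x≢y⇒x∈p-y b∈P (All.head b≢)))
        (subst (b ∈_) (sym (clique-removal f∈P)) (x∈p∧x≢y⇒x∈p-y b∈P (All.head (All.tail b≢))))

-- Regularity gives the isomorphism

module Forward (ω : ℕ) (4≤ω : 4 ≤ ω) (Γ : Graph) (simple : IsSimple Γ) (regular : Regular ω Γ) where
  open Cliques ω 4≤ω Γ simple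

  ∣star∣≡ω : ∀ v → ∣ star v ∣ ≡ ω
  ∣star∣≡ω v = trans (∣star∣≡degree v) (regular v)

  star-is-clique : ∀ v → ∃ λ a → clique a ≡ star v
  star-is-clique v = clique-in-star v ⊆-refl (∣star∣≡ω v)

  starClique : V → K
  starClique = proj₁ ∘ star-is-clique

  clique-starClique : ∀ v → clique (starClique v) ≡ star v
  clique-starClique = proj₂ ∘ star-is-clique

  clique≡star : ∀ a → clique a ≡ star (centre a)
  clique≡star a = clique≡star-centre (≤-reflexive (regular (centre a)))

  centre-starClique : ∀ v → centre (starClique v) ≡ v
  centre-starClique v = centre-unique (2≤∣clique∣ (starClique v))
    (clique⊆star-centre (starClique v)) (⊆-reflexive (clique-starClique v))

  starClique-centre : ∀ a → starClique (centre a) ≡ a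
  starClique-centre a = clique-injective (trans (clique-starClique (centre a)) (sym (clique≡star a)))

  adj-centre⇔ : ∀ {a b} → Adj C a b ⇔ Adj Γ (centre a) (centre b)
  adj-centre⇔ {a} {b} = mk⇔
    (λ a~b → let a≢b , e , e∈a∩b = to adj-cliqueGraph⇔ a~b
                 e∈a , e∈b = x∈p∩q⁻ _ _ e∈a∩b
             in endpoints-adjacent (a≢b ∘ cong clique ∘ centres⇒equal)
                  (∈-star⁻ (centre a) (clique⊆star-centre a e∈a)) (∈-star⁻ (centre b) (clique⊆star-centre b e∈b)))
    (λ ca~cb → let e , ca∈e , cb∈e = edge-between ca~cb in
      sharing-cliques-adjacent (Adj⇒≢ ca~cb ∘ cong centre ∘ clique-injective)
        (subst (e ∈_) (sym (clique≡star a)) (∈-star⁺ ca∈e))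
        (subst (e ∈_) (sym (clique≡star b)) (∈-star⁺ cb∈e)))
    where
    centres⇒equal : centre a ≡ centre b → a ≡ b
    centres⇒equal eq = trans (sym (starClique-centre a)) (trans (cong starClique eq) (starClique-centre b))

  cliqueGraph≅Γ : C ≅ Γ
  cliqueGraph≅Γ = mk↔ₛ′ centre starClique centre-starClique starClique-centre , λ a b → T⇔T⇒≡ adj-centre⇔

-- The isomorphism forces regularity

module Backward (ω : ℕ) (4≤ω : 4 ≤ ω) (Γ : Graph) (simple : IsSimple Γ)
                (iso : cliqueGraph ω (lineGraph Γ) ≅ Γ) where
  open Cliques ω 4≤ω Γ simple

  private
    variable
      a b aʸ aᶻ : K
      u v w z : V
      e f e₀ eʸ eᶻ : E

  φ : K → V
  φ = Inverse.to (proj₁ iso)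

  φ⁻¹ : V → K
  φ⁻¹ = Inverse.from (proj₁ iso)

  φ-injective : Injective _≡_ _≡_ φ
  φ-injective {a} {b} eq = trans (sym (Inverse.strictlyInverseʳ (proj₁ iso) a))
    (trans (cong φ⁻¹ eq) (Inverse.strictlyInverseʳ (proj₁ iso) b))

  φ⁻¹-injective : Injective _≡_ _≡_ φ⁻¹
  φ⁻¹-injective {u} {v} eq = trans (sym (Inverse.strictlyInverseˡ (proj₁ iso) u))
    (trans (cong φ eq) (Inverse.strictlyInverseˡ (proj₁ iso) v))

  adj-φ⇔ : Adj C a b ⇔ Adj Γ (φ a) (φ b)
  adj-φ⇔ {a} {b} = mk⇔ (subst T (proj₂ iso a b)) (subst T (sym (proj₂ iso a b)))

  deg : V → ℕ
  deg = degree Γ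

  degreeC≤ : ∀ a → degree C a ≤ deg (φ a)
  degreeC≤ = injectiveHomomorphism⇒degree≤ C Γ φ φ-injective (to adj-φ⇔)

  3≤ω : 3 ≤ ω
  3≤ω = ≤-trans (n≤1+n 3) 4≤ω

  maxDegree≤ω⇒ω≤degree : (∀ u → deg u ≤ ω) → ∀ v → ω ≤ deg v
  maxDegree≤ω⇒ω≤degree deg≤ω v
    with distinct-covers (centre ∘ φ⁻¹) centre∘φ⁻¹-injective (λ _ → ∈⊤) (≤-reflexive (∣⊤∣≡n _)) (∈⊤ {x = v})
    where
    centre∘φ⁻¹-injective : Injective _≡_ _≡_ (centre ∘ φ⁻¹)
    centre∘φ⁻¹-injective {u} {w} eq = φ⁻¹-injective (clique-injective (begin
      clique (φ⁻¹ u)           ≡⟨ clique≡star-centre (deg≤ω _) ⟩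
      star (centre (φ⁻¹ u))    ≡⟨ cong star eq ⟩
      star (centre (φ⁻¹ w))    ≡⟨ clique≡star-centre (deg≤ω _) ⟨
      clique (φ⁻¹ w)           ∎))
      where open ≡-Reasoning
  ... | u , refl = begin
    ω                          ≡⟨ ∣clique∣≡ω (φ⁻¹ u) ⟨
    ∣ clique (φ⁻¹ u) ∣         ≤⟨ p⊆q⇒∣p∣≤∣q∣ (clique⊆star-centre (φ⁻¹ u)) ⟩
    ∣ star (centre (φ⁻¹ u)) ∣  ≡⟨ ∣star∣≡degree _ ⟩
    deg (centre (φ⁻¹ u))       ∎
    where open ≤-Reasoning

  -- Exchanging one edge of an ω-subset S of a star for an edge of the star outside S gives
  -- another ω-clique meeting S, and distinct exchanges give distinct cliques.
  exchanges≤degree : ∀ v {S} (S⊆star : S ⊆ star v) (∣S∣≡ω : ∣ S ∣ ≡ ω) →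
                     ω * ∣ star v ─ S ∣ ≤ degree C (proj₁ (clique-in-star v S⊆star ∣S∣≡ω))
  exchanges≤degree v {S} S⊆star ∣S∣≡ω =
    subst (λ k → k * ∣ star v ─ S ∣ ≤ degree C aₛ) ∣S∣≡ω
      (injection₂⇒*≤ exchanged (λ x∈S y∈out → from ∈-tabulate (exchanged-adjacent x∈S y∈out)) exchanged-injective)
    where
    aₛ : K
    aₛ = proj₁ (clique-in-star v S⊆star ∣S∣≡ω)
    clique-aₛ : clique aₛ ≡ S
    clique-aₛ = proj₂ (clique-in-star v S⊆star ∣S∣≡ω)
    exchanged-clique : ∀ {x y} → x ∈ S → y ∈ star v ─ S → ∃ λ a → clique a ≡ exchange S x y
    exchanged-clique x∈S y∈out = clique-in-star v (exchange⊆ S⊆star (p─q⊆p _ _ y∈out))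
      (trans (∣exchange∣ x∈S (x∈p─q⇒x∉q y∈out)) ∣S∣≡ω)
    exchanged : ∀ {x y} → x ∈ S → y ∈ star v ─ S → K
    exchanged x∈S y∈out = proj₁ (exchanged-clique x∈S y∈out)
    clique-exchanged : ∀ {x y} (x∈S : x ∈ S) (y∈out : y ∈ star v ─ S) → clique (exchanged x∈S y∈out) ≡ exchange S x y
    clique-exchanged x∈S y∈out = proj₂ (exchanged-clique x∈S y∈out)
    exchanged-adjacent : ∀ {x y} (x∈S : x ∈ S) (y∈out : y ∈ star v ─ S) → Adj C aₛ (exchanged x∈S y∈out)
    exchanged-adjacent {x} {y} x∈S y∈out =
      let e , e∈S , e≢ = ∃-∈-avoiding S (x ∷ []) (subst (1 <_) (sym ∣S∣≡ω) 2≤ω)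
          y∈exchanged = subst (y ∈_) (sym (clique-exchanged x∈S y∈out)) ∈-exchange-new
      in sharing-cliques-adjacent
        (λ same → x∈p─q⇒x∉q y∈out (subst (y ∈_) (trans (sym same) clique-aₛ) y∈exchanged))
        (subst (e ∈_) (sym clique-aₛ) e∈S)
        (subst (e ∈_) (sym (clique-exchanged x∈S y∈out)) (∈-exchange-kept e∈S (All.head e≢)))
    exchanged-injective : ∀ {x y x′ y′} (x∈S : x ∈ S) (y∈out : y ∈ star v ─ S)
                          (x′∈S : x′ ∈ S) (y′∈out : y′ ∈ star v ─ S) →
                          exchanged x∈S y∈out ≡ exchanged x′∈S y′∈out → x ≡ x′ × y ≡ y′
    exchanged-injective x∈S y∈out x′∈S y′∈out same =
      exchange-injective x∈S (x∈p─q⇒x∉q y∈out) x′∈S (x∈p─q⇒x∉q y′∈out)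
      (trans (sym (clique-exchanged x∈S y∈out)) (trans (cong clique same) (clique-exchanged x′∈S y′∈out)))

  2+ω≤degree⇒larger-degree : 2 + ω ≤ deg v → ∃ λ u → deg v < deg u
  2+ω≤degree⇒larger-degree {v} 2+ω≤deg
    with ∃-⊆-between (⊥⊆ {p = star v}) (subst (_≤ ω) (sym (∣⊥∣≡0 (size L))) z≤n) ω≤∣star∣
    where
    ω≤∣star∣ : ω ≤ ∣ star v ∣
    ω≤∣star∣ = subst (ω ≤_) (sym (∣star∣≡degree v)) (m+n≤o⇒n≤o 2 2+ω≤deg)
  ... | S , _ , S⊆star , ∣S∣≡ω = φ aₛ , (begin-strict
    deg v                   ≡⟨ deg≡ω+∣out∣ ⟩
    ω + ∣ star v ─ S ∣      <⟨ ω+t<ω*t 3≤ω 2≤∣out∣ ⟩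
    ω * ∣ star v ─ S ∣      ≤⟨ exchanges≤degree v S⊆star ∣S∣≡ω ⟩
    degree C aₛ             ≤⟨ degreeC≤ aₛ ⟩
    deg (φ aₛ)              ∎)
    where
    open ≤-Reasoning
    aₛ : K
    aₛ = proj₁ (clique-in-star v S⊆star ∣S∣≡ω)
    deg≡ω+∣out∣ : deg v ≡ ω + ∣ star v ─ S ∣
    deg≡ω+∣out∣ = trans (sym (∣star∣≡degree v)) (trans (q⊆p⇒∣p∣≡∣q∣+∣p─q∣ S⊆star) (cong (_+ _) ∣S∣≡ω))
    2≤∣out∣ : 2 ≤ ∣ star v ─ S ∣
    2≤∣out∣ = +-cancelˡ-≤ ω 2 _ (subst₂ _≤_ (+-comm 2 ω) deg≡ω+∣out∣ 2+ω≤deg)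

  -- Besides the ω cliques star x - e (e ≠ e₀), the clique star x - e₀ meets the given
  -- cliques inside star y and star z.
  star-minus-degree : (deg≡1+ω : deg x ≡ ℕ.suc ω) (e₀∈P : e₀ ∈ star x) → x ≢ y → x ≢ z → y ≢ z →
                      clique aʸ ⊆ star y → clique aᶻ ⊆ star z → eʸ ∈ clique aʸ → eᶻ ∈ clique aᶻ →
                      eʸ ∈ star x - e₀ → eᶻ ∈ star x - e₀ →
                      2 + ω ≤ degree C (Removals.removal x deg≡1+ω e₀∈P)
  star-minus-degree {x} {e₀} {y} {z} {aʸ} {aᶻ} {eʸ} {eᶻ}
    deg≡1+ω e₀∈P x≢y x≢z y≢z aʸ⊆star-y aᶻ⊆star-z eʸ∈aʸ eᶻ∈aᶻ eʸ∈S eᶻ∈S = begin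
    2 + ω                   ≡⟨ cong (2 +_) (∣P-e∣≡ω e₀∈P) ⟨
    2 + ∣ S ∣               ≤⟨ distinct⇒≤∣∣ neighbour neighbour-injective (from ∈-tabulate ∘ neighbour-adjacent) ⟩
    degree C (removal e₀∈P) ∎
    where
    open ≤-Reasoning
    open Removals x deg≡1+ω
    S : Subset (size L)
    S = P - e₀
    others : Fin ∣ S ∣ → K
    others = removal ∘ p─q⊆p P ⁅ e₀ ⁆ ∘ enumerate-∈ S
    others-injective : Injective _≡_ _≡_ others
    others-injective = enumerate-injective S ∘ removal-injective _ _
    neighbour : Fin (2 + ∣ S ∣) → K
    neighbour = aʸ ◂ aᶻ ◂ others
    in-distinct-stars : clique a ⊆ star u → clique b ⊆ star v → u ≢ v → a ≢ b
    in-distinct-stars a⊆u b⊆v u≢v = cliques-in-distinct-stars a⊆u b⊆v u≢v ∘ cong clique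
    neighbour-injective : Injective _≡_ _≡_ neighbour
    neighbour-injective = ◂-injective (◂-injective others-injective
        (λ k → in-distinct-stars (removal⊆star _) aᶻ⊆star-z x≢z))
      λ { zero    → in-distinct-stars aᶻ⊆star-z aʸ⊆star-y (y≢z ∘ sym)
        ; (suc k) → in-distinct-stars (removal⊆star _) aʸ⊆star-y x≢y }
    neighbour-adjacent : ∀ k → Adj C (removal e₀∈P) (neighbour k)
    neighbour-adjacent zero          = sharing-cliques-adjacent
      (cliques-in-distinct-stars (removal⊆star e₀∈P) aʸ⊆star-y x≢y)
      (subst (eʸ ∈_) (sym (clique-removal e₀∈P)) eʸ∈S) eʸ∈aʸ
    neighbour-adjacent (suc zero)    = sharing-cliques-adjacent
      (cliques-in-distinct-stars (removal⊆star e₀∈P) aᶻ⊆star-z x≢z)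
      (subst (eᶻ ∈_) (sym (clique-removal e₀∈P)) eᶻ∈S) eᶻ∈aᶻ
    neighbour-adjacent (suc (suc k)) = removal-adjacent _ _ (x∈p-y⇒x≢y (enumerate-∈ S k) ∘ sym)

  two-heavy-neighbours⇒2+ω≤degree : deg x ≡ ℕ.suc ω → Adj Γ x y → Adj Γ x z → y ≢ z →
                                    ω ≤ deg y → ω ≤ deg z → ∃ λ u → 2 + ω ≤ deg u
  two-heavy-neighbours⇒2+ω≤degree {x} deg≡1+ω x~y x~z y≢z ω≤y ω≤z =
    let eʸ , x∈eʸ , y∈eʸ = edge-between x~y
        eᶻ , x∈eᶻ , z∈eᶻ = edge-between x~z
        e₀ , e₀∈R , e₀≢ = ∃-∈-avoiding (star x) (eʸ ∷ eᶻ ∷ []) (Removals.2<∣P∣ x deg≡1+ω)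
        aʸ , aʸ⊆star-y , eʸ∈aʸ = clique-through ω≤y (∈-star⁺ y∈eʸ)
        aᶻ , aᶻ⊆star-z , eᶻ∈aᶻ = clique-through ω≤z (∈-star⁺ z∈eᶻ)
        aₛ = Removals.removal x deg≡1+ω e₀∈R
    in φ aₛ , ≤-trans
      (star-minus-degree deg≡1+ω e₀∈R (Adj⇒≢ x~y) (Adj⇒≢ x~z) y≢z aʸ⊆star-y aᶻ⊆star-z eʸ∈aʸ eᶻ∈aᶻ
        (x∈p∧x≢y⇒x∈p-y (∈-star⁺ x∈eʸ) (All.head e₀≢ ∘ sym))
        (x∈p∧x≢y⇒x∈p-y (∈-star⁺ x∈eᶻ) (All.head (All.tail e₀≢) ∘ sym)))
      (degreeC≤ aₛ)

  -- The images X e of the cliques star v₀ - e have degree exactly ω and are pairwise adjacent,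
  -- so no edge leaves them; by connectedness v₀ would be one of them.
  maxDegree≢1+ω : Connected Γ → (∀ u → deg u ≤ ℕ.suc ω) → deg v ≢ ℕ.suc ω
  maxDegree≢1+ω {v₀} connected bounded deg≡1+ω =
    let e₀ , e₀∈P , _ = ∃-∈-avoiding P [] (<-trans (s≤s z≤n) 2<∣P∣)
        _ , e∈P , Xe≡v₀ = fold (λ u w → Image u → Image w) (λ u~w continue → continue ∘ Image-closed u~w) id
                            (connected (X e₀∈P) v₀) (e₀ , e₀∈P , refl)
    in 1+n≢n (trans (sym deg≡1+ω) (trans (cong deg (sym Xe≡v₀)) (deg-X≡ω e∈P)))
    where
    open Removals v₀ deg≡1+ω
    X : e ∈ P → V
    X = φ ∘ removal
    others : e ∈ P → i ∈ P - e → V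
    others e∈P i∈P-e = X (p─q⊆p _ _ i∈P-e)
    others-adjacent : (e∈P : e ∈ P) (i∈P-e : i ∈ P - e) → Adj Γ (X e∈P) (others e∈P i∈P-e)
    others-adjacent e∈P i∈P-e = to adj-φ⇔ (removal-adjacent e∈P _ (x∈p-y⇒x≢y i∈P-e ∘ sym))
    others-injective : (e∈P : e ∈ P) (i∈ : i ∈ P - e) (j∈ : j ∈ P - e) → others e∈P i∈ ≡ others e∈P j∈ → i ≡ j
    others-injective e∈P i∈ j∈ = removal-injective _ _ ∘ φ-injective
    ω≤deg-X : (e∈P : e ∈ P) → ω ≤ deg (X e∈P)
    ω≤deg-X e∈P = subst (_≤ deg (X e∈P)) (∣P-e∣≡ω e∈P)
      (injection⇒∣∣≤ (others e∈P) (from ∈-tabulate ∘ others-adjacent e∈P) (others-injective e∈P))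
    deg-X≢1+ω : (e∈P : e ∈ P) → deg (X e∈P) ≢ ℕ.suc ω
    deg-X≢1+ω e∈P deg-X≡1+ω =
      let i , j , i∈ , j∈ , i≢j = ∃-distinct-pair (subst (2 ≤_) (sym (∣P-e∣≡ω e∈P)) 2≤ω)
          u , 2+ω≤deg = two-heavy-neighbours⇒2+ω≤degree deg-X≡1+ω
            (others-adjacent e∈P i∈) (others-adjacent e∈P j∈) (i≢j ∘ others-injective e∈P i∈ j∈)
            (ω≤deg-X _) (ω≤deg-X _)
      in <-irrefl refl (≤-trans 2+ω≤deg (bounded u))
    deg-X≡ω : (e∈P : e ∈ P) → deg (X e∈P) ≡ ω
    deg-X≡ω e∈P = ≤-antisym (≤-pred (≤∧≢⇒< (bounded (X e∈P)) (deg-X≢1+ω e∈P))) (ω≤deg-X e∈P)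
    Image : V → Set
    Image w = ∃ λ e → Σ (e ∈ P) λ e∈P → X e∈P ≡ w
    Image-closed : Adj Γ u w → Image u → Image w
    Image-closed u~w (e , e∈P , refl) =
      let i , i∈P-e , Xi≡w = injection-covers (others e∈P) (from ∈-tabulate ∘ others-adjacent e∈P)
                               (others-injective e∈P) (≤-reflexive (trans (deg-X≡ω e∈P) (sym (∣P-e∣≡ω e∈P))))
                               (from ∈-tabulate u~w)
      in i , p─q⊆p _ _ i∈P-e , Xi≡w

  regular : Connected Γ → Regular ω Γ
  regular connected v = ≤-antisym (≤-trans (≤-maximal v) maximal≤ω)
    (maxDegree≤ω⇒ω≤degree (λ u → ≤-trans (≤-maximal u) maximal≤ω) v)
    where
    maximal : V
    maximal = argmax deg v (allFin _)
    ≤-maximal : ∀ u → deg u ≤ deg maximal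
    ≤-maximal u = All.lookup (f[xs]≤f[argmax] v (allFin _)) (Listₚ.∈-allFin u)
    maximal≤ω : deg maximal ≤ ω
    maximal≤ω with <-cmp (deg maximal) (ℕ.suc ω)
    ... | tri< Δ<1+ω _ _ = ≤-pred Δ<1+ω
    ... | tri≈ _ Δ≡1+ω _ = contradiction Δ≡1+ω
      (maxDegree≢1+ω connected (λ u → ≤-trans (≤-maximal u) (≤-reflexive Δ≡1+ω)))
    ... | tri> _ _ 1+ω<Δ = let u , Δ<deg-u = 2+ω≤degree⇒larger-degree 1+ω<Δ
                           in contradiction (≤-maximal u) (<⇒≱ Δ<deg-u)

theorem2p7 : (ω : ℕ) → 4 ≤ ω → (Γ : Graph) → IsSimple Γ → Connected Γ →
    (cliqueGraph ω (lineGraph Γ) ≅ Γ) ⇔ Regular ω Γ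
theorem2p7 ω 4≤ω Γ simple connected =
  mk⇔ (λ iso → Backward.regular ω 4≤ω Γ simple iso connected)
      (λ regular → Forward.cliqueGraph≅Γ ω 4≤ω Γ simple regular)
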